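{- Let $\langle\Delta_n:n\in\omega\rangle$ be a sequence of bipartite graphs with $|U^{\Delta_n}|=|V^{\Delta_n}|=\aleph_0$ for each $n$, such that for each $n$ and every finite $F\subseteq U^{\Delta_n}$ there is $v\in V^{\Delta_n}$ with $uE^{\Delta_n}v$ for all $u\in F$. Then for every nonprincipal ultrafilter $q$ over $\omega$, the ultraproduct $R=\prod_{n\in\omega}\Delta_n/q$ satisfies: there exists a sequence $\langle v_i:i<\mathfrak{d}\rangle$ with each $v_i\in V^R$ such that for every $u\in U^R$ there is $i<\mathfrak{d}$ with $uE^Rv_i$.
   Context: Let $L=\{E,U,V\}$ with $E$ binary and $U,V$ unary; an $L$-structure $M$ is a bipartite graph if $U^M\cup V^M=|M|$, $U^M\cap V^M=\emptyset$, and $xE^My$ implies $x\in U^M$, $y\in V^M$. $\mathfrak{d}$ is the dominating number: the least size of a family $D\subseteq\omega^\omega$ such that every $f\in\omega^\omega$ is eventually strictly dominated by some $g\in D$. -}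

module Defs where

open import Data.Nat using (ℕ; _<_; _≥_)
open import Data.Product using (Σ; _×_; proj₁)
open import Data.Sum using (_⊎_)
open import Data.Empty using (⊥)
open import Data.Unit using (⊤)
open import Data.List using (List)
open import Data.List.Relation.Unary.All using (All)
open import Relation.Nullary using (¬_)
open import Relation.Binary.PropositionalEquality using (_≡_)
open import Function.Bundles using (_↔_)
open import Function.Definitions using (Injective)

record BipartiteGraph : Set₁ where
  field
    Carrier : Set
    U V     : Carrier → Set
    E       : Carrier → Carrier → Set
    U-prop  : ∀ {x} (p q : U x) → p ≡ q
    V-prop  : ∀ {x} (p q : V x) → p ≡ q
    cover   : ∀ x → U x ⊎ V x
    disj    : ∀ x → ¬ (U x × V x)
    edge    : ∀ {x y} → E x y → U x × V y
open BipartiteGraph public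

BothPartsCountablyInfinite : BipartiteGraph → Set
BothPartsCountablyInfinite Δ =
  (Σ (Carrier Δ) (U Δ) ↔ ℕ) × (Σ (Carrier Δ) (V Δ) ↔ ℕ)

FiniteCommonNeighbours : BipartiteGraph → Set
FiniteCommonNeighbours Δ =
  (F : List (Σ (Carrier Δ) (U Δ))) →
  Σ (Carrier Δ) λ v → V Δ v × All (λ u → E Δ (proj₁ u) v) F

Subset : Set₁
Subset = ℕ → Set

_⊆_ : Subset → Subset → Set
A ⊆ B = ∀ n → A n → B n

record NonprincipalUltrafilter (q : Subset → Set) : Set₁ where
  field
    full        : q (λ _ → ⊤)
    no-empty    : ¬ q (λ _ → ⊥)
    upward      : ∀ {A B} → A ⊆ B → q A → q B
    intersect   : ∀ {A B} → q A → q B → q (λ n → A n × B n)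
    ultra       : ∀ A → q A ⊎ q (λ n → ¬ A n)
    nonprincipal : ∀ k → ¬ q (λ n → n ≡ k)

-- Ultraproduct R = Π Δ_n / q : elements are represented by their
-- representatives in Π Δ_n; the relations are evaluated via q (Łoś for atoms).
UltraCarrier : (ℕ → BipartiteGraph) → Set
UltraCarrier Δ = (n : ℕ) → Carrier (Δ n)

U^R : (q : Subset → Set) (Δ : ℕ → BipartiteGraph) → UltraCarrier Δ → Set
U^R q Δ x = q (λ n → U (Δ n) (x n))

V^R : (q : Subset → Set) (Δ : ℕ → BipartiteGraph) → UltraCarrier Δ → Set
V^R q Δ x = q (λ n → V (Δ n) (x n))

E^R : (q : Subset → Set) (Δ : ℕ → BipartiteGraph) → UltraCarrier Δ → UltraCarrier Δ → Set
E^R q Δ x y = q (λ n → E (Δ n) (x n) (y n))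

_<*_ : (ℕ → ℕ) → (ℕ → ℕ) → Set
f <* g = Σ ℕ λ N → ∀ n → n ≥ N → f n < g n

Dominating : {I : Set} → (I → (ℕ → ℕ)) → Set
Dominating {I} D = ∀ f → Σ I λ i → f <* D i

HasCardinalityDominatingNumber : Set → Set₁
HasCardinalityDominatingNumber I =
  Σ (I → (ℕ → ℕ)) Dominating ×
  ((J : Set) (D : J → (ℕ → ℕ)) → Dominating D →
     Σ (I → J) λ h → Injective _≡_ _≡_ h)

-- Enumerate U^{Δ_n} as u_0, u_1, …; a vertex u ∈ U^{Δ_n} then has an index,
-- and any element of U^R gives a function n ↦ index of its n-th coordinate.
-- For g in a dominating family of size 𝔡 let v_g be the element whose n-th
-- coordinate is a common neighbour of the first g(n) vertices of U^{Δ_n}.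
-- If g eventually dominates the index function of u, then u E v_g holds on a
-- cofinite set of coordinates, which a nonprincipal ultrafilter contains.
module Submission where

open import Defs
open import Data.Nat using (ℕ; zero; suc; _<_; _≥_; s≤s⁻¹)
open import Data.Nat.Properties using (≤∧≢⇒<; ≰⇒>)
open import Data.Product using (Σ; _×_; _,_; proj₁; proj₂)
open import Data.Sum using (inj₁; inj₂)
open import Data.Empty using (⊥-elim)
open import Data.List using (List; applyUpTo)
open import Data.List.Relation.Unary.All.Properties using (applyUpTo⁻)
open import Relation.Nullary using (¬_)
open import Relation.Binary.PropositionalEquality using (_≡_; subst)
open import Function.Bundles using (_↔_; Inverse)

module _ {q : Subset → Set} (uf : NonprincipalUltrafilter q) where
  open NonprincipalUltrafilter uf

  initialSegment∉ : ∀ N → ¬ q (λ n → n < N)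
  initialSegment∉ zero n<0∈q = no-empty (upward (λ _ ()) n<0∈q)
  initialSegment∉ (suc N) n<N+1∈q with ultra (λ n → n ≡ N)
  ... | inj₁ ≡N∈q = nonprincipal N ≡N∈q
  ... | inj₂ ≢N∈q = initialSegment∉ N (upward below (intersect n<N+1∈q ≢N∈q))
    where
    below : (λ n → n < suc N × ¬ n ≡ N) ⊆ (λ n → n < N)
    below n (n<N+1 , n≢N) = ≤∧≢⇒< (s≤s⁻¹ n<N+1) n≢N

  finalSegment∈ : ∀ N → q (λ n → n ≥ N)
  finalSegment∈ N with ultra (λ n → n ≥ N)
  ... | inj₁ ≥N∈q = ≥N∈q
  ... | inj₂ ≱N∈q = ⊥-elim (initialSegment∉ N (upward (λ _ → ≰⇒>) ≱N∈q))

module Enumerated (Δ : BipartiteGraph) (enumU : Σ (Carrier Δ) (U Δ) ↔ ℕ)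
                  (commonNeighbours : FiniteCommonNeighbours Δ) where

  -- Junk value 0 on V; the index is only ever consulted on U.
  index : Carrier Δ → ℕ
  index x with cover Δ x
  ... | inj₁ x∈U = Inverse.to enumU (x , x∈U)
  ... | inj₂ _   = 0

  firstVertices : ℕ → List (Σ (Carrier Δ) (U Δ))
  firstVertices m = applyUpTo (Inverse.from enumU) m

  neighbourOfFirst : ℕ → Carrier Δ
  neighbourOfFirst m = proj₁ (commonNeighbours (firstVertices m))

  neighbourOfFirst∈V : ∀ m → V Δ (neighbourOfFirst m)
  neighbourOfFirst∈V m = proj₁ (proj₂ (commonNeighbours (firstVertices m)))

  neighbourOfFirst-adjacent : ∀ {m u} → U Δ u → index u < m → E Δ u (neighbourOfFirst m)
  neighbourOfFirst-adjacent {m} {u} u∈U index<m with cover Δ u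
  ... | inj₂ u∈V = ⊥-elim (disj Δ u (u∈U , u∈V))
  ... | inj₁ u∈U′ =
    subst (λ w → E Δ (proj₁ w) (neighbourOfFirst m))
      (Inverse.strictlyInverseʳ enumU (u , u∈U′))
      (applyUpTo⁻ (Inverse.from enumU) m
        (proj₂ (proj₂ (commonNeighbours (firstVertices m)))) index<m)

module Covering (Δ : ℕ → BipartiteGraph) (enumU : ∀ n → Σ (Carrier (Δ n)) (U (Δ n)) ↔ ℕ)
                (commonNeighbours : ∀ n → FiniteCommonNeighbours (Δ n))
                {q : Subset → Set} (uf : NonprincipalUltrafilter q) where
  open NonprincipalUltrafilter uf
  open module Δₙ n = Enumerated (Δ n) (enumU n) (commonNeighbours n)

  dominatedNeighbour : (ℕ → ℕ) → UltraCarrier Δ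
  dominatedNeighbour g n = neighbourOfFirst n (g n)

  dominatedNeighbour∈V^R : ∀ g → V^R q Δ (dominatedNeighbour g)
  dominatedNeighbour∈V^R g = upward (λ n _ → neighbourOfFirst∈V n (g n)) full

  dominatedNeighbour-adjacent : ∀ u g → (λ n → index n (u n)) <* g → U^R q Δ u →
                                E^R q Δ u (dominatedNeighbour g)
  dominatedNeighbour-adjacent u g (N , index<g) u∈U^R =
    upward adjacent (intersect u∈U^R (finalSegment∈ uf N))
    where
    adjacent : (λ n → U (Δ n) (u n) × n ≥ N) ⊆ (λ n → E (Δ n) (u n) (dominatedNeighbour g n))
    adjacent n (uₙ∈U , n≥N) = neighbourOfFirst-adjacent n uₙ∈U (index<g n n≥N)

  dominatingFamily-covers : ∀ {I} (D : I → ℕ → ℕ) → Dominating D →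
    (u : UltraCarrier Δ) → U^R q Δ u → Σ I λ i → E^R q Δ u (dominatedNeighbour (D i))
  dominatingFamily-covers D dominating u u∈U^R =
    let i , index<*Dᵢ = dominating (λ n → index n (u n))
    in  i , dominatedNeighbour-adjacent u (D i) index<*Dᵢ u∈U^R

lemma4p8 : (Δ : ℕ → BipartiteGraph) →
    (∀ n → BothPartsCountablyInfinite (Δ n)) →
    (∀ n → FiniteCommonNeighbours (Δ n)) →
    (q : Subset → Set) → NonprincipalUltrafilter q →
    (I : Set) → HasCardinalityDominatingNumber I →
    Σ (I → UltraCarrier Δ) λ v →
      ((i : I) → V^R q Δ (v i)) ×
      ((u : UltraCarrier Δ) → U^R q Δ u → Σ I λ i → E^R q Δ u (v i))
lemma4p8 Δ countable commonNeighbours q uf I ((D , dominating) , _) =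
  (λ i → dominatedNeighbour (D i)) ,
  (λ i → dominatedNeighbour∈V^R (D i)) ,
  dominatingFamily-covers D dominating
  where open Covering Δ (λ n → proj₁ (countable n)) commonNeighbours uf
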